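{- For all integers $n\ge 0$ and $k$, $$\mathfrak B_{2n}^{(k)}=\sum_{m=0}^n\left\{ {n \atop m} \right\}_2\frac{(-1)^{n-m}(2m)!}{(2m+1)^k}.$$
   Context: The Stirling numbers of the second kind with level $2$, $\left\{ {n \atop k} \right\}_2$ ($n,k\ge0$), are defined by $\left\{ {n \atop k} \right\}_2=\left\{ {n-1 \atop k-1} \right\}_2+k^2\left\{ {n-1 \atop k} \right\}_2$ with $\left\{ {0 \atop 0} \right\}_2=1$ and $\left\{ {n \atop 0} \right\}_2=\left\{ {0 \atop n} \right\}_2=0$ for $n\ge1$. For an integer $k$, the poly-Bernoulli numbers with level $2$, $\mathfrak B_n^{(k)}$, are defined by the power series identity $$\sum_{n=0}^\infty\mathfrak B_n^{(k)}\frac{x^n}{n!}=\frac{{\rm Li}_{2,k}\bigl(2\sin(x/2)\bigr)}{2\sin(x/2)}=\sum_{m=0}^\infty\frac{\bigl(2\sin(x/2)\bigr)^{2m}}{(2m+1)^k},$$ where ${\rm Li}_{2,k}(z)=\sum_{n=0}^\infty\frac{z^{2n+1}}{(2n+1)^k}$. -}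

module Defs where

open import Data.Nat as ℕ using (ℕ; zero; suc; _∸_)
open import Data.Nat using (_!)
open import Data.Integer as ℤ using (ℤ; +_; -[1+_])
open import Data.Rational using (ℚ; 0ℚ; 1ℚ; _+_; _*_; -_; _/_)

_^ℚ_ : ℚ → ℕ → ℚ
q ^ℚ zero = 1ℚ
q ^ℚ suc n = q * (q ^ℚ n)

ℕ→ℚ : ℕ → ℚ
ℕ→ℚ n = (+ n) / 1

Σ≤ : ℕ → (ℕ → ℚ) → ℚ
Σ≤ zero f = f zero
Σ≤ (suc n) f = Σ≤ n f + f (suc n)

S2 : ℕ → ℕ → ℕ
S2 zero zero = 1
S2 zero (suc k) = 0
S2 (suc n) zero = 0
S2 (suc n) (suc k) = S2 n k ℕ.+ (suc k ℕ.* suc k) ℕ.* S2 n (suc k)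

invPow : ℕ → ℤ → ℚ
invPow m (+ n) = ((+ 1) / suc (2 ℕ.* m)) ^ℚ n
invPow m -[1+ n ] = ℕ→ℚ (suc (2 ℕ.* m)) ^ℚ suc n

sgn : ℕ → ℚ
sgn n = (- 1ℚ) ^ℚ n

-- Taylor coefficients of 2 sin(x/2) = Σ_j (-1)^j x^(2j+1) / (2^(2j) (2j+1)!)
sinCoef : ℕ → ℚ
sinCoef zero = 0ℚ
sinCoef (suc zero) = 1ℚ
sinCoef (suc (suc i)) = - (sinCoef i * ((+ 1) / (suc (suc i) ℕ.* suc i ℕ.* 4)))

-- coefficient of x^n in (2 sin(x/2))^p, as a formal power series (Cauchy product)
powCoef : ℕ → ℕ → ℚ
powCoef zero zero = 1ℚ
powCoef zero (suc n) = 0ℚ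
powCoef (suc p) n = Σ≤ n (λ i → sinCoef i * powCoef p (n ∸ i))

-- poly-Bernoulli numbers with level 2:
-- B n k = n! [x^n] Σ_m (2 sin(x/2))^(2m) / (2m+1)^k
-- (terms with 2m > n vanish, so the sum over m ≤ n is exact)
polyB2 : ℕ → ℤ → ℚ
polyB2 n k = ℕ→ℚ (n !) * Σ≤ n (λ m → powCoef (2 ℕ.* m) n * invPow m k)

-- Write σ = 2 sin(x/2) and γ = σ′ = cos(x/2). Then γ′ = -σ/4 and γ² + σ²/4 = 1 (its derivative
-- vanishes), so the chain rule gives the differential equation
--   (σᵖ)″ = p (p - 1) σᵖ⁻² - (p²/4) σᵖ.
-- Reading off coefficients, c(n, m) = (2n)! [x²ⁿ] σ²ᵐ obeys
--   c(n+1, m+1) = (2m+2)(2m+1) c(n, m) - (m+1)² c(n, m+1),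
-- which is the recurrence of S2(n, m) (-1)ⁿ⁻ᵐ (2m)!; as the two agree for n = 0 and for m = 0 they are equal, and the
-- theorem is the definition of the poly-Bernoulli numbers with the terms m > n (where S2 vanishes) removed.
-- Power series are coefficient functions ℕ → ℚ; commutativity and associativity of their product follow
-- from the Leibniz rule by induction on the degree, since over ℚ a coefficient is determined by the
-- corresponding coefficient of the derivative.
module Submission where

open import Defs
open import Data.Nat as ℕ using (ℕ; zero; suc; 2+; _∸_; _*_; _!; _≤_; _<_; z≤n; s≤s)
import Data.Nat.Properties as ℕₚ
open import Data.Integer as ℤ using (ℤ; +_)
import Data.Integer.Properties as ℤ
open import Data.Rational using (ℚ; 0ℚ; 1ℚ; _+_; -_; _/_; toℚᵘ) renaming (_*_ to _·_)
open import Data.Rational.Properties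
  using ( toℚᵘ-injective; toℚᵘ-fromℚᵘ; toℚᵘ-homo-+; toℚᵘ-homo-*
        ; *-assoc; *-comm; *-identityˡ; *-identityʳ; *-zeroˡ; *-zeroʳ; *-distribˡ-+; *-distribʳ-+
        ; +-assoc; +-comm; +-identityˡ; +-identityʳ)
open import Data.Rational.Unnormalised as ℚᵘ using (mkℚᵘ; *≡*)
import Data.Rational.Unnormalised.Properties as ℚᵘ
open import Data.Rational.Solver using (module +-*-Solver)
open import Data.Sum using (inj₁; inj₂)
open import Relation.Nullary using (yes; no)
open import Relation.Binary.PropositionalEquality using (_≡_; refl; sym; trans; cong; cong₂; module ≡-Reasoning)

open +-*-Solver

toℚᵘ-ℕ→ℚ : ∀ n → toℚᵘ (ℕ→ℚ n) ℚᵘ.≃ mkℚᵘ (+ n) 0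
toℚᵘ-ℕ→ℚ n = toℚᵘ-fromℚᵘ (mkℚᵘ (+ n) 0)

ℕ→ℚ-+ : ∀ m n → ℕ→ℚ (m ℕ.+ n) ≡ ℕ→ℚ m + ℕ→ℚ n
ℕ→ℚ-+ m n = toℚᵘ-injective (begin
  toℚᵘ (ℕ→ℚ (m ℕ.+ n))            ≈⟨ toℚᵘ-ℕ→ℚ (m ℕ.+ n) ⟩
  mkℚᵘ (+ (m ℕ.+ n)) 0             ≈⟨ *≡* (cong (ℤ._* + 1) +-homo) ⟩
  mkℚᵘ (+ m) 0 ℚᵘ.+ mkℚᵘ (+ n) 0   ≈⟨ ℚᵘ.≃-sym (ℚᵘ.+-cong (toℚᵘ-ℕ→ℚ m) (toℚᵘ-ℕ→ℚ n)) ⟩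
  toℚᵘ (ℕ→ℚ m) ℚᵘ.+ toℚᵘ (ℕ→ℚ n)  ≈⟨ ℚᵘ.≃-sym (toℚᵘ-homo-+ (ℕ→ℚ m) (ℕ→ℚ n)) ⟩
  toℚᵘ (ℕ→ℚ m + ℕ→ℚ n)            ∎)
  where
  open ℚᵘ.≃-Reasoning
  +-homo : + (m ℕ.+ n) ≡ + m ℤ.* + 1 ℤ.+ + n ℤ.* + 1
  +-homo = trans (ℤ.pos-+ m n) (sym (cong₂ ℤ._+_ (ℤ.*-identityʳ (+ m)) (ℤ.*-identityʳ (+ n))))

ℕ→ℚ-* : ∀ m n → ℕ→ℚ (m * n) ≡ ℕ→ℚ m · ℕ→ℚ n
ℕ→ℚ-* m n = toℚᵘ-injective (begin
  toℚᵘ (ℕ→ℚ (m * n))              ≈⟨ toℚᵘ-ℕ→ℚ (m * n) ⟩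
  mkℚᵘ (+ (m * n)) 0               ≈⟨ *≡* (cong (ℤ._* + 1) (ℤ.pos-* m n)) ⟩
  mkℚᵘ (+ m) 0 ℚᵘ.* mkℚᵘ (+ n) 0   ≈⟨ ℚᵘ.≃-sym (ℚᵘ.*-cong (toℚᵘ-ℕ→ℚ m) (toℚᵘ-ℕ→ℚ n)) ⟩
  toℚᵘ (ℕ→ℚ m) ℚᵘ.* toℚᵘ (ℕ→ℚ n)  ≈⟨ ℚᵘ.≃-sym (toℚᵘ-homo-* (ℕ→ℚ m) (ℕ→ℚ n)) ⟩
  toℚᵘ (ℕ→ℚ m · ℕ→ℚ n)            ∎)
  where open ℚᵘ.≃-Reasoning

ℕ→ℚ-suc : ∀ n → ℕ→ℚ (suc n) ≡ 1ℚ + ℕ→ℚ n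
ℕ→ℚ-suc = ℕ→ℚ-+ 1

ℕ→ℚ-2+! : ∀ n → ℕ→ℚ ((2+ n) !) ≡ ℕ→ℚ (2+ n) · (ℕ→ℚ (suc n) · ℕ→ℚ (n !))
ℕ→ℚ-2+! n = trans (ℕ→ℚ-* (2+ n) (suc n !)) (cong (ℕ→ℚ (2+ n) ·_) (ℕ→ℚ-* (suc n) (n !)))

ℕ→ℚ-inverseʳ : ∀ n .{{_ : ℕ.NonZero n}} → ℕ→ℚ n · ((+ 1) / n) ≡ 1ℚ
ℕ→ℚ-inverseʳ n@(suc n-1) = toℚᵘ-injective (begin
  toℚᵘ (ℕ→ℚ n · ((+ 1) / n))                ≈⟨ toℚᵘ-homo-* (ℕ→ℚ n) ((+ 1) / n) ⟩
  toℚᵘ (ℕ→ℚ n) ℚᵘ.* toℚᵘ ((+ 1) / n)        ≈⟨ ℚᵘ.*-cong (toℚᵘ-ℕ→ℚ n) (toℚᵘ-fromℚᵘ (mkℚᵘ (+ 1) n-1)) ⟩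
  mkℚᵘ (+ n) 0 ℚᵘ.* mkℚᵘ (+ 1) n-1          ≈⟨ *≡* cross-products ⟩
  toℚᵘ 1ℚ                                    ∎)
  where
  open ℚᵘ.≃-Reasoning
  cross-products : (+ n ℤ.* + 1) ℤ.* + 1 ≡ + 1 ℤ.* + (1 * n)
  cross-products = trans (ℤ.*-identityʳ _) (trans (ℤ.*-identityʳ (+ n)) (sym (trans (ℤ.*-identityˡ _) (cong +_ (ℕₚ.*-identityˡ n)))))

ℕ→ℚ-suc-cancelˡ : ∀ n {x y} → ℕ→ℚ (suc n) · x ≡ ℕ→ℚ (suc n) · y → x ≡ y
ℕ→ℚ-suc-cancelˡ n {x} {y} eq = trans (unscale x) (trans (cong (a⁻¹ ·_) eq) (sym (unscale y)))
  where
  open ≡-Reasoning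
  a a⁻¹ : ℚ
  a = ℕ→ℚ (suc n)
  a⁻¹ = (+ 1) / suc n
  unscale : ∀ z → z ≡ a⁻¹ · (a · z)
  unscale z = begin
    z              ≡⟨ sym (*-identityˡ z) ⟩
    1ℚ · z         ≡⟨ cong (_· z) (sym (ℕ→ℚ-inverseʳ (suc n))) ⟩
    (a · a⁻¹) · z  ≡⟨ solve 3 (λ a b z → (a :* b) :* z := b :* (a :* z)) refl a a⁻¹ z ⟩
    a⁻¹ · (a · z)  ∎

Σ≤-cong-≤ : ∀ n {f g : ℕ → ℚ} → (∀ i → i ≤ n → f i ≡ g i) → Σ≤ n f ≡ Σ≤ n g
Σ≤-cong-≤ zero    f≡g = f≡g 0 z≤n
Σ≤-cong-≤ (suc n) f≡g = cong₂ _+_ (Σ≤-cong-≤ n (λ i i≤n → f≡g i (ℕₚ.m≤n⇒m≤1+n i≤n))) (f≡g (suc n) ℕₚ.≤-refl)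

Σ≤-cong : ∀ n {f g : ℕ → ℚ} → (∀ i → f i ≡ g i) → Σ≤ n f ≡ Σ≤ n g
Σ≤-cong n f≡g = Σ≤-cong-≤ n (λ i _ → f≡g i)

Σ≤-+ : ∀ n (f g : ℕ → ℚ) → Σ≤ n (λ i → f i + g i) ≡ Σ≤ n f + Σ≤ n g
Σ≤-+ zero    f g = refl
Σ≤-+ (suc n) f g = trans (cong (_+ (f (suc n) + g (suc n))) (Σ≤-+ n f g))
  (solve 4 (λ a b c d → (a :+ b) :+ (c :+ d) := (a :+ c) :+ (b :+ d)) refl (Σ≤ n f) (Σ≤ n g) (f (suc n)) (g (suc n)))

Σ≤-·ˡ : ∀ n c (f : ℕ → ℚ) → Σ≤ n (λ i → c · f i) ≡ c · Σ≤ n f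
Σ≤-·ˡ zero    c f = refl
Σ≤-·ˡ (suc n) c f = trans (cong (_+ c · f (suc n)) (Σ≤-·ˡ n c f)) (sym (*-distribˡ-+ c (Σ≤ n f) (f (suc n))))

Σ≤-suc : ∀ n (f : ℕ → ℚ) → Σ≤ (suc n) f ≡ f 0 + Σ≤ n (λ i → f (suc i))
Σ≤-suc zero    f = refl
Σ≤-suc (suc n) f = trans (cong (_+ f (suc (suc n))) (Σ≤-suc n f))
  (solve 3 (λ a b c → (a :+ b) :+ c := a :+ (b :+ c)) refl (f 0) (Σ≤ n (λ i → f (suc i))) (f (suc (suc n))))

Σ≤-0 : ∀ n {f : ℕ → ℚ} → (∀ i → f i ≡ 0ℚ) → Σ≤ n f ≡ 0ℚ
Σ≤-0 zero    f≡0 = f≡0 0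
Σ≤-0 (suc n) f≡0 = cong₂ _+_ (Σ≤-0 n f≡0) (f≡0 (suc n))

Σ≤-trailing-0 : ∀ {m} n {f : ℕ → ℚ} → m ≤ n → (∀ i → m < i → f i ≡ 0ℚ) → Σ≤ n f ≡ Σ≤ m f
Σ≤-trailing-0 zero    z≤n  _   = refl
Σ≤-trailing-0 {m} (suc n) {f} m≤1+n f≡0 with ℕₚ.m≤n⇒m<n∨m≡n m≤1+n
... | inj₂ refl = refl
... | inj₁ (s≤s m≤n) = begin
  Σ≤ n f + f (suc n)  ≡⟨ cong₂ _+_ (Σ≤-trailing-0 n m≤n f≡0) (f≡0 (suc n) (s≤s m≤n)) ⟩
  Σ≤ m f + 0ℚ         ≡⟨ +-identityʳ _ ⟩
  Σ≤ m f              ∎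
  where open ≡-Reasoning

-- Formal power series over ℚ

Series : Set
Series = ℕ → ℚ

infix  4 _≈_
infixl 6 _⊕_
infixr 8 _•_
infixl 7 _⊛_

_≈_ : Series → Series → Set
f ≈ g = ∀ n → f n ≡ g n

_⊕_ : Series → Series → Series
(f ⊕ g) n = f n + g n

_•_ : ℚ → Series → Series
(c • f) n = c · f n

_⊛_ : Series → Series → Series
(f ⊛ g) n = Σ≤ n (λ i → f i · g (n ∸ i))

∂ : Series → Series
∂ f n = ℕ→ℚ (suc n) · f (suc n)

𝟘 : Series
𝟘 _ = 0ℚ

𝟙 : Series
𝟙 = powCoef 0

⊛-congˡ : ∀ {f f′} g → f ≈ f′ → f ⊛ g ≈ f′ ⊛ g
⊛-congˡ g f≈f′ n = Σ≤-cong n (λ i → cong (_· g (n ∸ i)) (f≈f′ i))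

⊛-congʳ : ∀ f {g g′} → g ≈ g′ → f ⊛ g ≈ f ⊛ g′
⊛-congʳ f g≈g′ n = Σ≤-cong n (λ i → cong (f i ·_) (g≈g′ (n ∸ i)))

⊛-distribˡ-⊕ : ∀ f g h → f ⊛ (g ⊕ h) ≈ f ⊛ g ⊕ f ⊛ h
⊛-distribˡ-⊕ f g h n = trans (Σ≤-cong n (λ i → *-distribˡ-+ (f i) (g (n ∸ i)) (h (n ∸ i)))) (Σ≤-+ n _ _)

⊛-distribʳ-⊕ : ∀ f g h → (f ⊕ g) ⊛ h ≈ f ⊛ h ⊕ g ⊛ h
⊛-distribʳ-⊕ f g h n = trans (Σ≤-cong n (λ i → *-distribʳ-+ (h (n ∸ i)) (f i) (g i))) (Σ≤-+ n _ _)

•-⊛ : ∀ c f g → c • f ⊛ g ≈ c • (f ⊛ g)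
•-⊛ c f g n = trans (Σ≤-cong n (λ i → *-assoc c (f i) (g (n ∸ i)))) (Σ≤-·ˡ n c _)

⊛-• : ∀ c f g → f ⊛ c • g ≈ c • (f ⊛ g)
⊛-• c f g n = trans (Σ≤-cong n (λ i → solve 3 (λ a b c → a :* (c :* b) := c :* (a :* b)) refl (f i) (g (n ∸ i)) c)) (Σ≤-·ˡ n c _)

⊛-zeroʳ : ∀ f → f ⊛ 𝟘 ≈ 𝟘
⊛-zeroʳ f n = Σ≤-0 n (λ i → *-zeroʳ (f i))

⊛-identityˡ : ∀ f → 𝟙 ⊛ f ≈ f
⊛-identityˡ f zero    = *-identityˡ (f 0)
⊛-identityˡ f (suc n) = begin
  (𝟙 ⊛ f) (suc n)                                ≡⟨ Σ≤-suc n _ ⟩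
  1ℚ · f (suc n) + Σ≤ n (λ i → 0ℚ · f (n ∸ i))  ≡⟨ cong₂ _+_ (*-identityˡ (f (suc n))) (Σ≤-0 n (λ i → *-zeroˡ (f (n ∸ i)))) ⟩
  f (suc n) + 0ℚ                                 ≡⟨ +-identityʳ _ ⟩
  f (suc n)                                      ∎
  where open ≡-Reasoning

∂-cancel : ∀ f g n → ∂ f n ≡ ∂ g n → f (suc n) ≡ g (suc n)
∂-cancel f g n = ℕ→ℚ-suc-cancelˡ n

∂-𝟙 : ∂ 𝟙 ≈ 𝟘
∂-𝟙 n = *-zeroʳ (ℕ→ℚ (suc n))

∂-cong : ∀ {f g} → f ≈ g → ∂ f ≈ ∂ g
∂-cong f≈g n = cong (ℕ→ℚ (suc n) ·_) (f≈g (suc n))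

∂-⊕ : ∀ f g → ∂ (f ⊕ g) ≈ ∂ f ⊕ ∂ g
∂-⊕ f g n = *-distribˡ-+ (ℕ→ℚ (suc n)) (f (suc n)) (g (suc n))

∂-• : ∀ c f → ∂ (c • f) ≈ c • ∂ f
∂-• c f n = solve 3 (λ a c x → a :* (c :* x) := c :* (a :* x)) refl (ℕ→ℚ (suc n)) c (f (suc n))

∂-⊛ : ∀ f g → ∂ (f ⊛ g) ≈ ∂ f ⊛ g ⊕ f ⊛ ∂ g
∂-⊛ f g n = begin
  ℕ→ℚ (suc n) · Σ≤ (suc n) T                              ≡⟨ sym (Σ≤-·ˡ (suc n) (ℕ→ℚ (suc n)) T) ⟩
  Σ≤ (suc n) (λ i → ℕ→ℚ (suc n) · T i)                    ≡⟨ Σ≤-cong-≤ (suc n) split ⟩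
  Σ≤ (suc n) (λ i → ℕ→ℚ i · T i + ℕ→ℚ (suc n ∸ i) · T i)  ≡⟨ Σ≤-+ (suc n) _ _ ⟩
  Σ≤ (suc n) (λ i → ℕ→ℚ i · T i) + Σ≤ (suc n) (λ i → ℕ→ℚ (suc n ∸ i) · T i)
                                                           ≡⟨ cong₂ _+_ left right ⟩
  (∂ f ⊛ g) n + (f ⊛ ∂ g) n                                ∎
  where
  open ≡-Reasoning
  T : ℕ → ℚ
  T i = f i · g (suc n ∸ i)

  split : ∀ i → i ≤ suc n → ℕ→ℚ (suc n) · T i ≡ ℕ→ℚ i · T i + ℕ→ℚ (suc n ∸ i) · T i
  split i i≤1+n = begin
    ℕ→ℚ (suc n) · T i                ≡⟨ cong (λ m → ℕ→ℚ m · T i) (sym (ℕₚ.m+[n∸m]≡n i≤1+n)) ⟩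
    ℕ→ℚ (i ℕ.+ (suc n ∸ i)) · T i    ≡⟨ cong (_· T i) (ℕ→ℚ-+ i (suc n ∸ i)) ⟩
    (ℕ→ℚ i + ℕ→ℚ (suc n ∸ i)) · T i  ≡⟨ *-distribʳ-+ (T i) (ℕ→ℚ i) (ℕ→ℚ (suc n ∸ i)) ⟩
    ℕ→ℚ i · T i + ℕ→ℚ (suc n ∸ i) · T i ∎

  left : Σ≤ (suc n) (λ i → ℕ→ℚ i · T i) ≡ (∂ f ⊛ g) n
  left = begin
    Σ≤ (suc n) (λ i → ℕ→ℚ i · T i)                    ≡⟨ Σ≤-suc n _ ⟩
    0ℚ · T 0 + Σ≤ n (λ i → ℕ→ℚ (suc i) · T (suc i))  ≡⟨ cong (_+ Σ≤ n (λ i → ℕ→ℚ (suc i) · T (suc i))) (*-zeroˡ (T 0)) ⟩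
    0ℚ + Σ≤ n (λ i → ℕ→ℚ (suc i) · T (suc i))        ≡⟨ +-identityˡ _ ⟩
    Σ≤ n (λ i → ℕ→ℚ (suc i) · T (suc i))             ≡⟨ Σ≤-cong n (λ i → sym (*-assoc (ℕ→ℚ (suc i)) (f (suc i)) (g (n ∸ i)))) ⟩
    (∂ f ⊛ g) n                                       ∎

  right-term : ∀ i → i ≤ n → ℕ→ℚ (suc n ∸ i) · T i ≡ f i · ∂ g (n ∸ i)
  right-term i i≤n = begin
    ℕ→ℚ (suc n ∸ i) · (f i · g (suc n ∸ i))          ≡⟨ cong (λ m → ℕ→ℚ m · (f i · g m)) (ℕₚ.+-∸-assoc 1 i≤n) ⟩
    ℕ→ℚ (suc (n ∸ i)) · (f i · g (suc (n ∸ i)))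
      ≡⟨ solve 3 (λ a b c → a :* (b :* c) := b :* (a :* c)) refl (ℕ→ℚ (suc (n ∸ i))) (f i) (g (suc (n ∸ i))) ⟩
    f i · ∂ g (n ∸ i)                                 ∎

  right : Σ≤ (suc n) (λ i → ℕ→ℚ (suc n ∸ i) · T i) ≡ (f ⊛ ∂ g) n
  right = begin
    Σ≤ n (λ i → ℕ→ℚ (suc n ∸ i) · T i) + ℕ→ℚ (n ∸ n) · T (suc n)
                                   ≡⟨ cong₂ _+_ (Σ≤-cong-≤ n right-term) (cong (λ m → ℕ→ℚ m · T (suc n)) (ℕₚ.n∸n≡0 n)) ⟩
    (f ⊛ ∂ g) n + 0ℚ · T (suc n)   ≡⟨ cong (λ x → (f ⊛ ∂ g) n + x) (*-zeroˡ (T (suc n))) ⟩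
    (f ⊛ ∂ g) n + 0ℚ               ≡⟨ +-identityʳ _ ⟩
    (f ⊛ ∂ g) n                    ∎

⊛-comm : ∀ f g → f ⊛ g ≈ g ⊛ f
⊛-comm f g zero    = *-comm (f 0) (g 0)
⊛-comm f g (suc n) = ∂-cancel (f ⊛ g) (g ⊛ f) n (begin
  ∂ (f ⊛ g) n                  ≡⟨ ∂-⊛ f g n ⟩
  (∂ f ⊛ g) n + (f ⊛ ∂ g) n    ≡⟨ cong₂ _+_ (⊛-comm (∂ f) g n) (⊛-comm f (∂ g) n) ⟩
  (g ⊛ ∂ f) n + (∂ g ⊛ f) n    ≡⟨ +-comm ((g ⊛ ∂ f) n) ((∂ g ⊛ f) n) ⟩
  (∂ g ⊛ f) n + (g ⊛ ∂ f) n    ≡⟨ sym (∂-⊛ g f n) ⟩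
  ∂ (g ⊛ f) n                  ∎)
  where open ≡-Reasoning

⊛-assoc : ∀ f g h → (f ⊛ g) ⊛ h ≈ f ⊛ (g ⊛ h)
⊛-assoc f g h zero    = *-assoc (f 0) (g 0) (h 0)
⊛-assoc f g h (suc n) = ∂-cancel ((f ⊛ g) ⊛ h) (f ⊛ (g ⊛ h)) n (begin
  ∂ ((f ⊛ g) ⊛ h) n                                                   ≡⟨ ∂-⊛ (f ⊛ g) h n ⟩
  (∂ (f ⊛ g) ⊛ h) n + ((f ⊛ g) ⊛ ∂ h) n
                       ≡⟨ cong (_+ ((f ⊛ g) ⊛ ∂ h) n) (trans (⊛-congˡ h (∂-⊛ f g) n) (⊛-distribʳ-⊕ (∂ f ⊛ g) (f ⊛ ∂ g) h n)) ⟩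
  ((∂ f ⊛ g) ⊛ h) n + ((f ⊛ ∂ g) ⊛ h) n + ((f ⊛ g) ⊛ ∂ h) n
                       ≡⟨ cong₂ _+_ (cong₂ _+_ (⊛-assoc (∂ f) g h n) (⊛-assoc f (∂ g) h n)) (⊛-assoc f g (∂ h) n) ⟩
  (∂ f ⊛ (g ⊛ h)) n + (f ⊛ (∂ g ⊛ h)) n + (f ⊛ (g ⊛ ∂ h)) n
                       ≡⟨ +-assoc ((∂ f ⊛ (g ⊛ h)) n) ((f ⊛ (∂ g ⊛ h)) n) ((f ⊛ (g ⊛ ∂ h)) n) ⟩
  (∂ f ⊛ (g ⊛ h)) n + ((f ⊛ (∂ g ⊛ h)) n + (f ⊛ (g ⊛ ∂ h)) n)
                       ≡⟨ cong (λ x → (∂ f ⊛ (g ⊛ h)) n + x) (sym (trans (⊛-congʳ f (∂-⊛ g h) n) (⊛-distribˡ-⊕ f (∂ g ⊛ h) (g ⊛ ∂ h) n))) ⟩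
  (∂ f ⊛ (g ⊛ h)) n + (f ⊛ ∂ (g ⊛ h)) n                              ≡⟨ sym (∂-⊛ f (g ⊛ h) n) ⟩
  ∂ (f ⊛ (g ⊛ h)) n                                                   ∎)
  where open ≡-Reasoning

⊛-left-comm : ∀ f g h → f ⊛ (g ⊛ h) ≈ g ⊛ (f ⊛ h)
⊛-left-comm f g h n = begin
  (f ⊛ (g ⊛ h)) n  ≡⟨ sym (⊛-assoc f g h n) ⟩
  ((f ⊛ g) ⊛ h) n  ≡⟨ ⊛-congˡ h (⊛-comm f g) n ⟩
  ((g ⊛ f) ⊛ h) n  ≡⟨ ⊛-assoc g f h n ⟩
  (g ⊛ (f ⊛ h)) n  ∎
  where open ≡-Reasoning

-- The series 2 sin(x/2) and its powers

σ : Series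
σ = sinCoef

γ : Series
γ = ∂ σ

¼ : ℚ
¼ = + 1 / 4

∂γ : ∂ γ ≈ (- ¼) • σ
∂γ n = begin
  a · (b · - (σ n · w))
    ≡⟨ solve 4 (λ a b s w → a :* (b :* (:- (s :* w))) := (:- con ¼) :* s :* (b :* a :* con (ℕ→ℚ 4) :* w)) refl a b (σ n) w ⟩
  (- ¼) · σ n · (b · a · ℕ→ℚ 4 · w) ≡⟨ cong ((- ¼) · σ n ·_) b·a·4·w≡1 ⟩
  (- ¼) · σ n · 1ℚ                  ≡⟨ *-identityʳ ((- ¼) · σ n) ⟩
  (- ¼) · σ n                       ∎
  where
  open ≡-Reasoning
  a b w : ℚ
  a = ℕ→ℚ (suc n)
  b = ℕ→ℚ (suc (suc n))
  w = (+ 1) / (suc (suc n) * suc n * 4)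
  b·a·4·w≡1 : b · a · ℕ→ℚ 4 · w ≡ 1ℚ
  b·a·4·w≡1 = begin
    b · a · ℕ→ℚ 4 · w                       ≡⟨ cong (λ x → x · ℕ→ℚ 4 · w) (sym (ℕ→ℚ-* (suc (suc n)) (suc n))) ⟩
    ℕ→ℚ (suc (suc n) * suc n) · ℕ→ℚ 4 · w  ≡⟨ cong (_· w) (sym (ℕ→ℚ-* (suc (suc n) * suc n) 4)) ⟩
    ℕ→ℚ (suc (suc n) * suc n * 4) · w       ≡⟨ ℕ→ℚ-inverseʳ (suc (suc n) * suc n * 4) ⟩
    1ℚ                                       ∎

pythagoras : γ ⊛ γ ≈ 𝟙 ⊕ (- ¼) • (σ ⊛ σ)
pythagoras zero    = refl
pythagoras (suc n) = ∂-cancel (γ ⊛ γ) (𝟙 ⊕ (- ¼) • (σ ⊛ σ)) n (begin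
  ∂ (γ ⊛ γ) n                                      ≡⟨ ∂-⊛ γ γ n ⟩
  (∂ γ ⊛ γ) n + (γ ⊛ ∂ γ) n                        ≡⟨ cong₂ _+_ (trans (⊛-congˡ γ ∂γ n) (•-⊛ (- ¼) σ γ n))
                                                                 (trans (⊛-congʳ γ ∂γ n) (⊛-• (- ¼) γ σ n)) ⟩
  (- ¼) · (σ ⊛ γ) n + (- ¼) · (γ ⊛ σ) n
    ≡⟨ solve 3 (λ c x y → c :* x :+ c :* y := con 0ℚ :+ c :* (y :+ x)) refl (- ¼) ((σ ⊛ γ) n) ((γ ⊛ σ) n) ⟩
  0ℚ + (- ¼) · ((γ ⊛ σ) n + (σ ⊛ γ) n)             ≡⟨ cong₂ _+_ (sym (∂-𝟙 n)) (cong ((- ¼) ·_) (sym (∂-⊛ σ σ n))) ⟩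
  ∂ 𝟙 n + (- ¼) · ∂ (σ ⊛ σ) n
    ≡⟨ sym (trans (∂-⊕ 𝟙 ((- ¼) • (σ ⊛ σ)) n) (cong (λ x → ∂ 𝟙 n + x) (∂-• (- ¼) (σ ⊛ σ) n))) ⟩
  ∂ (𝟙 ⊕ (- ¼) • (σ ⊛ σ)) n                        ∎)
  where open ≡-Reasoning

∂-powCoef : ∀ p → ∂ (powCoef (suc p)) ≈ ℕ→ℚ (suc p) • (γ ⊛ powCoef p)
∂-powCoef zero n = begin
  ∂ (σ ⊛ 𝟙) n                  ≡⟨ ∂-⊛ σ 𝟙 n ⟩
  (γ ⊛ 𝟙) n + (σ ⊛ ∂ 𝟙) n      ≡⟨ cong (λ x → (γ ⊛ 𝟙) n + x) (trans (⊛-congʳ σ ∂-𝟙 n) (⊛-zeroʳ σ n)) ⟩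
  (γ ⊛ 𝟙) n + 0ℚ               ≡⟨ +-identityʳ ((γ ⊛ 𝟙) n) ⟩
  (γ ⊛ 𝟙) n                    ≡⟨ sym (*-identityˡ ((γ ⊛ 𝟙) n)) ⟩
  1ℚ · (γ ⊛ 𝟙) n               ∎
  where open ≡-Reasoning
∂-powCoef (suc p) n = begin
  ∂ (σ ⊛ powCoef (suc p)) n                                 ≡⟨ ∂-⊛ σ (powCoef (suc p)) n ⟩
  (γ ⊛ powCoef (suc p)) n + (σ ⊛ ∂ (powCoef (suc p))) n    ≡⟨ cong (λ x → (γ ⊛ powCoef (suc p)) n + x) σ⊛∂powCoef ⟩
  (γ ⊛ powCoef (suc p)) n + c · (γ ⊛ powCoef (suc p)) n
    ≡⟨ solve 2 (λ x c → x :+ c :* x := (con 1ℚ :+ c) :* x) refl ((γ ⊛ powCoef (suc p)) n) c ⟩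
  (1ℚ + c) · (γ ⊛ powCoef (suc p)) n                       ≡⟨ cong (_· (γ ⊛ powCoef (suc p)) n) (sym (ℕ→ℚ-suc (suc p))) ⟩
  ℕ→ℚ (suc (suc p)) · (γ ⊛ powCoef (suc p)) n              ∎
  where
  open ≡-Reasoning
  c : ℚ
  c = ℕ→ℚ (suc p)
  σ⊛∂powCoef : (σ ⊛ ∂ (powCoef (suc p))) n ≡ c · (γ ⊛ powCoef (suc p)) n
  σ⊛∂powCoef = begin
    (σ ⊛ ∂ (powCoef (suc p))) n      ≡⟨ ⊛-congʳ σ (∂-powCoef p) n ⟩
    (σ ⊛ c • (γ ⊛ powCoef p)) n      ≡⟨ ⊛-• c σ (γ ⊛ powCoef p) n ⟩
    c · (σ ⊛ (γ ⊛ powCoef p)) n      ≡⟨ cong (c ·_) (⊛-left-comm σ γ (powCoef p) n) ⟩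
    c · (γ ⊛ powCoef (suc p)) n      ∎

∂∂-powCoef : ∀ p → ∂ (∂ (powCoef (2+ p))) ≈
  (ℕ→ℚ (2+ p) · ℕ→ℚ (suc p)) • powCoef p ⊕ (- (ℕ→ℚ (2+ p) · ℕ→ℚ (2+ p) · ¼)) • powCoef (2+ p)
∂∂-powCoef p n = begin
  ∂ (∂ (powCoef (2+ p))) n                         ≡⟨ ∂-cong (∂-powCoef (suc p)) n ⟩
  ∂ (b • (γ ⊛ powCoef (suc p))) n                   ≡⟨ ∂-• b (γ ⊛ powCoef (suc p)) n ⟩
  b · ∂ (γ ⊛ powCoef (suc p)) n                     ≡⟨ cong (b ·_) (∂-⊛ γ (powCoef (suc p)) n) ⟩
  b · ((∂ γ ⊛ powCoef (suc p)) n + (γ ⊛ ∂ (powCoef (suc p))) n)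
                                                    ≡⟨ cong (λ x → b · x) (cong₂ _+_ ∂γ-term γ-term) ⟩
  b · ((- ¼) · X + a · (Y + (- ¼) · X))             ≡⟨ cong (λ z → z · ((- ¼) · X + a · (Y + (- ¼) · X))) (ℕ→ℚ-suc (suc p)) ⟩
  (1ℚ + a) · ((- ¼) · X + a · (Y + (- ¼) · X))
    ≡⟨ solve 3 (λ a X Y → (con 1ℚ :+ a) :* ((:- con ¼) :* X :+ a :* (Y :+ (:- con ¼) :* X))
                         := (con 1ℚ :+ a) :* a :* Y :+ (:- ((con 1ℚ :+ a) :* (con 1ℚ :+ a) :* con ¼)) :* X) refl a X Y ⟩
  (1ℚ + a) · a · Y + (- ((1ℚ + a) · (1ℚ + a) · ¼)) · X
                                                    ≡⟨ cong (λ z → z · a · Y + (- (z · z · ¼)) · X) (sym (ℕ→ℚ-suc (suc p))) ⟩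
  b · a · Y + (- (b · b · ¼)) · X                   ∎
  where
  open ≡-Reasoning
  a b X Y : ℚ
  a = ℕ→ℚ (suc p)
  b = ℕ→ℚ (2+ p)
  X = powCoef (2+ p) n
  Y = powCoef p n
  ∂γ-term : (∂ γ ⊛ powCoef (suc p)) n ≡ (- ¼) · X
  ∂γ-term = trans (⊛-congˡ (powCoef (suc p)) ∂γ n) (•-⊛ (- ¼) σ (powCoef (suc p)) n)
  γ-term : (γ ⊛ ∂ (powCoef (suc p))) n ≡ a · (Y + (- ¼) · X)
  γ-term = begin
    (γ ⊛ ∂ (powCoef (suc p))) n                    ≡⟨ ⊛-congʳ γ (∂-powCoef p) n ⟩
    (γ ⊛ a • (γ ⊛ powCoef p)) n                    ≡⟨ ⊛-• a γ (γ ⊛ powCoef p) n ⟩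
    a · (γ ⊛ (γ ⊛ powCoef p)) n                    ≡⟨ cong (a ·_) (sym (⊛-assoc γ γ (powCoef p) n)) ⟩
    a · ((γ ⊛ γ) ⊛ powCoef p) n                    ≡⟨ cong (a ·_) (⊛-congˡ (powCoef p) pythagoras n) ⟩
    a · ((𝟙 ⊕ (- ¼) • (σ ⊛ σ)) ⊛ powCoef p) n      ≡⟨ cong (a ·_) (⊛-distribʳ-⊕ 𝟙 ((- ¼) • (σ ⊛ σ)) (powCoef p) n) ⟩
    a · ((𝟙 ⊛ powCoef p) n + ((- ¼) • (σ ⊛ σ) ⊛ powCoef p) n)
                                                   ≡⟨ cong (λ x → a · x) (cong₂ _+_ (⊛-identityˡ (powCoef p) n) σσ-term) ⟩
    a · (Y + (- ¼) · X)                            ∎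
    where
    σσ-term : ((- ¼) • (σ ⊛ σ) ⊛ powCoef p) n ≡ (- ¼) · X
    σσ-term = trans (•-⊛ (- ¼) (σ ⊛ σ) (powCoef p) n) (cong ((- ¼) ·_) (⊛-assoc σ σ (powCoef p) n))

-- Stirling numbers of level 2

S2-vanish : ∀ {n k} → n < k → S2 n k ≡ 0
S2-vanish {zero}  {suc k} _         = refl
S2-vanish {suc n} {suc k} (s≤s n<k) = begin
  S2 n k ℕ.+ suc k * suc k * S2 n (suc k)
    ≡⟨ cong₂ (λ x y → x ℕ.+ suc k * suc k * y) (S2-vanish n<k) (S2-vanish (ℕₚ.m≤n⇒m≤1+n n<k)) ⟩
  suc k * suc k * 0                        ≡⟨ ℕₚ.*-zeroʳ (suc k * suc k) ⟩
  0                                        ∎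
  where open ≡-Reasoning

ℕ→ℚ-S2 : ∀ n m → ℕ→ℚ (S2 (suc n) (suc m)) ≡ ℕ→ℚ (S2 n m) + ℕ→ℚ (suc m) · ℕ→ℚ (suc m) · ℕ→ℚ (S2 n (suc m))
ℕ→ℚ-S2 n m = begin
  ℕ→ℚ (S2 n m ℕ.+ suc m * suc m * S2 n (suc m))                   ≡⟨ ℕ→ℚ-+ (S2 n m) (suc m * suc m * S2 n (suc m)) ⟩
  ℕ→ℚ (S2 n m) + ℕ→ℚ (suc m * suc m * S2 n (suc m))
    ≡⟨ cong (λ x → ℕ→ℚ (S2 n m) + x) (ℕ→ℚ-* (suc m * suc m) (S2 n (suc m))) ⟩
  ℕ→ℚ (S2 n m) + ℕ→ℚ (suc m * suc m) · ℕ→ℚ (S2 n (suc m))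
    ≡⟨ cong (λ x → ℕ→ℚ (S2 n m) + x · ℕ→ℚ (S2 n (suc m))) (ℕ→ℚ-* (suc m) (suc m)) ⟩
  ℕ→ℚ (S2 n m) + ℕ→ℚ (suc m) · ℕ→ℚ (suc m) · ℕ→ℚ (S2 n (suc m))  ∎
  where open ≡-Reasoning

-- For m ≥ n truncated subtraction makes n ∸ suc m = n ∸ m, so the sign does not flip; but then
-- S2 n (suc m) = 0.
S2-sgn-suc : ∀ n m → ℕ→ℚ (S2 n (suc m)) · sgn (n ∸ suc m) ≡ - (ℕ→ℚ (S2 n (suc m)) · sgn (n ∸ m))
S2-sgn-suc n m with m ℕ.<? n
S2-sgn-suc (suc n) m | yes (s≤s m≤n) = begin
  s · sgn (n ∸ m)               ≡⟨ solve 2 (λ s x → s :* x := :- (s :* ((:- con 1ℚ) :* x))) refl s (sgn (n ∸ m)) ⟩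
  - (s · sgn (suc (n ∸ m)))     ≡⟨ cong (λ k → - (s · sgn k)) (sym (ℕₚ.+-∸-assoc 1 m≤n)) ⟩
  - (s · sgn (suc n ∸ m))       ∎
  where
  open ≡-Reasoning
  s : ℚ
  s = ℕ→ℚ (S2 (suc n) (suc m))
S2-sgn-suc n m | no m≮n rewrite S2-vanish (s≤s (ℕₚ.≮⇒≥ m≮n)) =
  trans (*-zeroˡ (sgn (n ∸ suc m))) (cong -_ (sym (*-zeroˡ (sgn (n ∸ m)))))

powEGF : ℕ → ℕ → ℚ
powEGF p n = ℕ→ℚ (n !) · powCoef p n

powEGF-recurrence : ∀ p n → powEGF (2+ p) (2+ n) ≡
  (ℕ→ℚ (2+ p) · ℕ→ℚ (suc p)) · powEGF p n + (- (ℕ→ℚ (2+ p) · ℕ→ℚ (2+ p) · ¼)) · powEGF (2+ p) n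
powEGF-recurrence p n = begin
  ℕ→ℚ ((2+ n) !) · X′                         ≡⟨ cong (_· X′) (ℕ→ℚ-2+! n) ⟩
  ℕ→ℚ (2+ n) · (ℕ→ℚ (suc n) · f) · X′
    ≡⟨ solve 4 (λ b a f x → b :* (a :* f) :* x := f :* (a :* (b :* x))) refl (ℕ→ℚ (2+ n)) (ℕ→ℚ (suc n)) f X′ ⟩
  f · ∂ (∂ (powCoef (2+ p))) n                ≡⟨ cong (f ·_) (∂∂-powCoef p n) ⟩
  f · (A · Y + B · X)
    ≡⟨ solve 5 (λ f A B X Y → f :* (A :* Y :+ B :* X) := A :* (f :* Y) :+ B :* (f :* X)) refl f A B X Y ⟩
  A · (f · Y) + B · (f · X)                   ∎
  where
  open ≡-Reasoning
  f A B X X′ Y : ℚ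
  f = ℕ→ℚ (n !)
  A = ℕ→ℚ (2+ p) · ℕ→ℚ (suc p)
  B = - (ℕ→ℚ (2+ p) · ℕ→ℚ (2+ p) · ¼)
  X = powCoef (2+ p) n
  X′ = powCoef (2+ p) (2+ n)
  Y = powCoef p n

powEGF-suc-0 : ∀ p → powEGF (suc p) 0 ≡ 0ℚ
powEGF-suc-0 p = trans (cong (ℕ→ℚ 1 ·_) (*-zeroˡ (powCoef p 0))) (*-zeroʳ (ℕ→ℚ 1))

powEGF-even : ∀ n m → powEGF (2 * m) (2 * n) ≡ ℕ→ℚ (S2 n m) · sgn (n ∸ m) · ℕ→ℚ ((2 * m) !)
powEGF-even zero    zero    = refl
powEGF-even zero    (suc m) = trans (cong (λ k → powEGF k 0) (ℕₚ.*-suc 2 m))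
  (trans (powEGF-suc-0 (suc (2 * m))) (sym (*-zeroˡ (ℕ→ℚ ((2 * suc m) !)))))
powEGF-even (suc n) zero    = trans (*-zeroʳ (ℕ→ℚ ((2 * suc n) !)))
  (sym (trans (cong (_· ℕ→ℚ 1) (*-zeroˡ (sgn (suc n)))) (*-zeroˡ (ℕ→ℚ 1))))
powEGF-even (suc n) (suc m) = begin
  powEGF (2 * suc m) (2 * suc n)                             ≡⟨ cong₂ powEGF (ℕₚ.*-suc 2 m) (ℕₚ.*-suc 2 n) ⟩
  powEGF (2+ M) (2+ N)                                       ≡⟨ powEGF-recurrence M N ⟩
  b · a · powEGF M N + (- (b · b · ¼)) · powEGF (2+ M) N
      ≡⟨ cong₂ (λ x y → b · a · x + (- (b · b · ¼)) · y) (powEGF-even n m)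
               (trans (cong (λ k → powEGF k N) (sym (ℕₚ.*-suc 2 m))) (powEGF-even n (suc m))) ⟩
  b · a · (s₀ · ε · f) + (- (b · b · ¼)) · (s₁ · sgn (n ∸ suc m) · ℕ→ℚ ((2 * suc m) !))
      ≡⟨ cong₂ (λ x y → b · a · (s₀ · ε · f) + (- x) · y) b·b·¼≡c·c (cong₂ _·_ (S2-sgn-suc n m) [2+2m]!) ⟩
  b · a · (s₀ · ε · f) + (- (c · c)) · (- (s₁ · ε) · (b · (a · f)))
      ≡⟨ solve 7 (λ a b c f s₀ s₁ ε → b :* a :* (s₀ :* ε :* f) :+ (:- (c :* c)) :* ((:- (s₁ :* ε)) :* (b :* (a :* f)))
                                     := (s₀ :+ c :* c :* s₁) :* ε :* (b :* (a :* f))) refl a b c f s₀ s₁ ε ⟩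
  (s₀ + c · c · s₁) · ε · (b · (a · f))
      ≡⟨ cong₂ (λ x y → x · ε · y) (sym (ℕ→ℚ-S2 n m)) (sym [2+2m]!) ⟩
  ℕ→ℚ (S2 (suc n) (suc m)) · ε · ℕ→ℚ ((2 * suc m) !)         ∎
  where
  open ≡-Reasoning
  M N : ℕ
  M = 2 * m
  N = 2 * n
  a b c f s₀ s₁ ε : ℚ
  a = ℕ→ℚ (suc M)
  b = ℕ→ℚ (2+ M)
  c = ℕ→ℚ (suc m)
  f = ℕ→ℚ (M !)
  s₀ = ℕ→ℚ (S2 n m)
  s₁ = ℕ→ℚ (S2 n (suc m))
  ε = sgn (n ∸ m)
  [2+2m]! : ℕ→ℚ ((2 * suc m) !) ≡ b · (a · f)
  [2+2m]! = trans (cong (λ k → ℕ→ℚ (k !)) (ℕₚ.*-suc 2 m)) (ℕ→ℚ-2+! M)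
  b·b·¼≡c·c : b · b · ¼ ≡ c · c
  b·b·¼≡c·c = begin
    b · b · ¼                                ≡⟨ cong (λ x → x · x · ¼) (trans (cong ℕ→ℚ (sym (ℕₚ.*-suc 2 m))) (ℕ→ℚ-* 2 (suc m))) ⟩
    (ℕ→ℚ 2 · c) · (ℕ→ℚ 2 · c) · ¼
      ≡⟨ solve 1 (λ c → (con (ℕ→ℚ 2) :* c) :* (con (ℕ→ℚ 2) :* c) :* con ¼ := c :* c) refl c ⟩
    c · c                                    ∎

theorem4 : (n : ℕ) (k : ℤ) →
    polyB2 (2 * n) k ≡
      Σ≤ n (λ m → ℕ→ℚ (S2 n m) Data.Rational.* sgn (n ∸ m) Data.Rational.* ℕ→ℚ ((2 * m) !) Data.Rational.* invPow m k)
theorem4 n k = begin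
  ℕ→ℚ ((2 * n) !) · Σ≤ (2 * n) (λ m → powCoef (2 * m) (2 * n) · invPow m k)
    ≡⟨ sym (Σ≤-·ˡ (2 * n) (ℕ→ℚ ((2 * n) !)) (λ m → powCoef (2 * m) (2 * n) · invPow m k)) ⟩
  Σ≤ (2 * n) (λ m → ℕ→ℚ ((2 * n) !) · (powCoef (2 * m) (2 * n) · invPow m k))
    ≡⟨ Σ≤-cong (2 * n) (λ m → trans (sym (*-assoc (ℕ→ℚ ((2 * n) !)) (powCoef (2 * m) (2 * n)) (invPow m k)))
                                      (cong (_· invPow m k) (powEGF-even n m))) ⟩
  Σ≤ (2 * n) term  ≡⟨ Σ≤-trailing-0 (2 * n) (ℕₚ.m≤n*m n 2) term-vanish ⟩
  Σ≤ n term        ∎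
  where
  open ≡-Reasoning
  term : ℕ → ℚ
  term m = ℕ→ℚ (S2 n m) · sgn (n ∸ m) · ℕ→ℚ ((2 * m) !) · invPow m k
  term-vanish : ∀ m → n < m → term m ≡ 0ℚ
  term-vanish m n<m rewrite S2-vanish n<m =
    trans (cong (λ x → x · ℕ→ℚ ((2 * m) !) · invPow m k) (*-zeroˡ (sgn (n ∸ m))))
      (trans (cong (_· invPow m k) (*-zeroˡ (ℕ→ℚ ((2 * m) !)))) (*-zeroˡ (invPow m k)))
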